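{- Let $q=2^s$. For $r\in\mathbb F_q$ define $$\mathbf S_r=\{x\in\mathbb F_{q^2}:x+x^2+\cdots+x^{q/2}=r\},\qquad \mathbf G_r=\{x\in\mathbb F_{q^2}:x^q+x=r\}.$$ Then $\mathbf S_0$ is the set of elements of $\mathbb F_q$ of absolute trace $0$, and $\mathbf S_1$ is the set of elements of $\mathbb F_q$ of absolute trace $1$. Moreover: (i) $\mathbf G_0=\mathbb F_q$. The sets $\mathbf G_r$ ($r\in\mathbb F_q$) are precisely the additive cosets of $\mathbb F_q$ in $\mathbb F_{q^2}$, and $\mathbf G_r+\mathbf G_s=\mathbf G_{r+s}$ for all $r,s\in\mathbb F_q$. Also $\mathbf G_r=r\mathbf G_1$ for $r\in\mathbb F_q^*$. (ii) The map $x\mapsto x^2+x$ maps $\mathbf G_r$ two-to-one onto $\mathbf S_r$. In particular $|\mathbf S_r|=q/2$, and the sets $\mathbf S_r$ ($r\in\mathbb F_q$) partition $\mathbf T_0$. The sets $\mathbf S_r$ are the cosets of $\mathbf S_0$ in $(\mathbf T_0,+)$, and $\mathbf S_r+\mathbf S_s=\mathbf S_{r+s}$ for all $r,s\in\mathbb F_q$. (iii) For each $r\in\mathbb F_q$, $\mathbf G_{r^2+r}=\mathbf S_r\cup\mathbf S_{r+1}$.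
   Context: $\mathbf T_0$ denotes the set of elements of $\mathbb F_{q^2}$ whose absolute trace (to $\mathbb F_2$) is $0$. -}

module Defs where

open import Level using (0ℓ)
open import Algebra.Bundles using (CommutativeRing)
import Data.Nat as ℕ
open ℕ using (ℕ; zero; suc; _^_)
open import Data.Fin using (Fin)
open import Data.Product using (Σ; ∃; _×_; _,_)
open import Data.Sum using (_⊎_)
open import Relation.Nullary using (¬_)
open import Relation.Binary.PropositionalEquality using (_≡_)

record FiniteField (n : ℕ) : Set₁ where
  field
    cring    : CommutativeRing 0ℓ 0ℓ
  open CommutativeRing cring public
  field
    1≉0      : ¬ (1# ≈ 0#)
    inverse  : ∀ x → ¬ (x ≈ 0#) → ∃ λ y → x * y ≈ 1#
    enum     : Fin n → Carrier
    enum-inj : ∀ i j → enum i ≈ enum j → i ≡ j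
    enum-sur : ∀ x → ∃ λ i → enum i ≈ x

module FieldNotions {n : ℕ} (F : FiniteField n) (s : ℕ) where
  open FiniteField F

  pow : Carrier → ℕ → Carrier
  pow x zero    = 1#
  pow x (suc k) = x * pow x k

  sumTo : ℕ → (ℕ → Carrier) → Carrier
  sumTo zero    f = 0#
  sumTo (suc k) f = sumTo k f + f k

  q : ℕ
  q = 2 ^ s

  _≐_ : (Carrier → Set) → (Carrier → Set) → Set
  P ≐ Q = ∀ x → ((P x → Q x) × (Q x → P x))

  _⊕_ : (Carrier → Set) → (Carrier → Set) → (Carrier → Set)
  (P ⊕ Q) x = ∃ λ y → ∃ λ z → P y × Q z × (x ≈ y + z)

  HasSize : (Carrier → Set) → ℕ → Set
  HasSize P k = Σ (Fin k → Carrier) λ e →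
    (∀ i → P (e i)) × (∀ i j → e i ≈ e j → i ≡ j) × (∀ x → P x → ∃ λ i → e i ≈ x)

  InFq : Carrier → Set
  InFq x = pow x q ≈ x

  -- absolute trace F_q → F_2 (applied to elements of F_q): Σ_{i<s} x^(2^i)
  trq : Carrier → Carrier
  trq x = sumTo s (λ i → pow x (2 ^ i))

  trq2 : Carrier → Carrier
  trq2 x = sumTo (2 ℕ.* s) (λ i → pow x (2 ^ i))

  T0 : Carrier → Set
  T0 x = trq2 x ≈ 0#

  S : Carrier → Carrier → Set
  S r x = sumTo s (λ i → pow x (2 ^ i)) ≈ r

  G : Carrier → Carrier → Set
  G r x = pow x q + x ≈ r

  φ : Carrier → Carrier
  φ x = x * x + x

  scaled : Carrier → (Carrier → Set) → (Carrier → Set)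
  scaled r P x = ∃ λ y → P y × (x ≈ r * y)

  IsCoset : (Carrier → Set) → Carrier → (Carrier → Set) → Set
  IsCoset H a P = P ≐ (λ x → H (x - a))

  TwoToOneOnto : (Carrier → Carrier) → (Carrier → Set) → (Carrier → Set) → Set
  TwoToOneOnto f P Q =
    (∀ x → P x → Q (f x)) ×
    (∀ y → Q y → ∃ λ x₁ → ∃ λ x₂ →
       ¬ (x₁ ≈ x₂) × P x₁ × P x₂ × f x₁ ≈ y × f x₂ ≈ y ×
       (∀ x → P x → f x ≈ y → (x ≈ x₁) ⊎ (x ≈ x₂)))

-- Write L x = x + x² + ⋯ + x^(q/2) (trq in Defs) and tr x = x^q + x, so that S_r and G_r are
-- the fibres of L and tr over r, and φ x = x² + x. In characteristic 2 all three maps are additive,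
-- and telescoping gives φ ∘ L = L ∘ φ = tr. Since x^(q²) = x, tr maps F_{q²} F_q-linearly onto
-- F_q = ker tr (F_q is not everything, as tr has only q roots), so the G_r are the cosets of F_q,
-- and counting the fibres of tr gives |F_q|² = q², i.e. |G_r| = q. As ker φ = {0, 1}, φ maps G_r
-- into S_r at most two-to-one, while L x = r has at most q/2 roots; hence |S_r| = q/2 and every
-- fibre has exactly two points. Part (iii) is ker φ = {0, 1} once more, read through φ ∘ L = tr;
-- and Tr_{q²} = L + L^q gives T₀ = ⋃ S_r.

module Submission where

open import Defs
open import Level using (0ℓ)
open import Data.Nat as Nat using (ℕ; zero; suc; _^_; _∸_; _≤_; _<_; z≤n; s≤s)
import Data.Nat.Properties as Nat
open import Data.Fin using (Fin; zero; suc; punchIn)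
open import Data.Fin.Properties as Fin using (punchInᵢ≢i; suc-injective)
import Algebra.Properties.CommutativeSemiring.Exp
import Algebra.Properties.CommutativeSemigroup
import Algebra.Properties.CommutativeMonoid.Sum
import Algebra.Properties.Ring
import Algebra.Solver.Ring.NaturalCoefficients.Default
open import Data.Product using (Σ; ∃; _×_; _,_; proj₁; proj₂)
import Data.Product
open import Data.Sum using (_⊎_; inj₁; inj₂; [_,_]′)
open import Data.Unit using (tt)
open import Data.Empty using (⊥-elim)
open import Function using (_∘_; id)
open import Data.Fin.Permutation using (Permutation; permutation; _⟨$⟩ʳ_)
open import Relation.Nullary using (¬_; ¬?; Dec; yes; no; contradiction)
open import Relation.Nullary.Decidable using (_×-dec_; _⊎-dec_; toSum)
open import Relation.Unary using (Pred; Decidable; _⊆_)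
open import Relation.Unary.Properties using (U?; ∁?)
open import Relation.Binary.Bundles using (Setoid)
import Relation.Binary.Reasoning.Setoid as ≈-Reasoning
open import Relation.Binary.Definitions using (_Respects_; tri<; tri≈; tri>)
open import Relation.Binary.PropositionalEquality as ≡ using (_≡_; _≢_)
open import Algebra.Properties.CommutativeMonoid.Sum Nat.+-0-commutativeMonoid
  using (sum; sum-syntax; ∑-distrib-+; ∑-comm; sum-cong-≗; sum-remove; sum-replicate-zero)
open import Algebra.Properties.Semiring.Sum Nat.+-*-semiring using (*-distribˡ-sum)

module _ where
  open import Data.Nat using (_+_; _*_)

  ∑-mono-≤ : ∀ {k} {f g : Fin k → ℕ} → (∀ i → f i ≤ g i) → sum f ≤ sum g
  ∑-mono-≤ {zero}  f≤g = z≤n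
  ∑-mono-≤ {suc k} f≤g = Nat.+-mono-≤ (f≤g zero) (∑-mono-≤ (f≤g ∘ suc))

  ∑-ones : ∀ k → ∑[ i < k ] 1 ≡ k
  ∑-ones zero    = ≡.refl
  ∑-ones (suc k) = ≡.cong suc (∑-ones k)

  ∑-positive : ∀ {k} (f : Fin k → ℕ) → 0 < sum f → ∃ λ i → 0 < f i
  ∑-positive {suc k} f pos with f zero in eq
  ... | suc _ = zero , ≡.subst (0 <_) (≡.sym eq) (s≤s z≤n)
  ... | zero  with ∑-positive (f ∘ suc) pos
  ...   | i , 0<fi = suc i , 0<fi

  ∑-single : ∀ {k} (f : Fin k → ℕ) j → f j ≡ 1 → (∀ i → i ≢ j → f i ≡ 0) → sum f ≡ 1
  ∑-single {suc k} f j fj≡1 f≡0 = ≡.trans (sum-remove {i = j} f) (≡.cong₂ _+_ fj≡1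
    (≡.trans (sum-cong-≗ λ i → f≡0 (punchIn j i) (punchInᵢ≢i j i)) (sum-replicate-zero k)))

  ∑-≤-≡ : ∀ {k} {f g : Fin k → ℕ} → (∀ i → f i ≤ g i) → sum f ≡ sum g → ∀ i → f i ≡ g i
  ∑-≤-≡ {suc k} {f} {g} f≤g Σf≡Σg = λ { zero → f₀≡g₀ ; (suc i) → ∑-≤-≡ (f≤g ∘ suc) Σf′≡Σg′ i }
    where
    f₀≡g₀ : f zero ≡ g zero
    f₀≡g₀ = Nat.≤-antisym (f≤g zero) (Nat.+-cancelʳ-≤ (sum (g ∘ suc)) (g zero) (f zero)
      (Nat.≤-trans (Nat.≤-reflexive (≡.sym Σf≡Σg)) (Nat.+-monoʳ-≤ (f zero) (∑-mono-≤ (f≤g ∘ suc)))))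
    Σf′≡Σg′ : sum (f ∘ suc) ≡ sum (g ∘ suc)
    Σf′≡Σg′ = Nat.+-cancelˡ-≡ (f zero) _ _ (≡.trans Σf≡Σg (≡.cong (_+ sum (g ∘ suc)) (≡.sym f₀≡g₀)))

  indicator : ∀ {ℓ} {A : Set ℓ} → Dec A → ℕ
  indicator (yes _) = 1
  indicator (no _)  = 0

  module _ {A : Set} where

    indicator-positive : (a : Dec A) → 0 < indicator a → A
    indicator-positive (yes a) _ = a

    indicator-*-≡ : ∀ {m c} (a : Dec A) → (A → m ≡ c) → indicator a * m ≡ c * indicator a
    indicator-*-≡ {m} {c} (yes a) m≡c = ≡.trans (Nat.*-identityˡ m) (≡.trans (m≡c a) (≡.sym (Nat.*-identityʳ c)))
    indicator-*-≡ {c = c} (no _)  _   = ≡.sym (Nat.*-zeroʳ c)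

    indicator-*-≤ : ∀ {m c} (a : Dec A) → (A → m ≤ c) → indicator a * m ≤ c * indicator a
    indicator-*-≤ {m} {c} (yes a) m≤c = Nat.≤-trans (Nat.≤-reflexive (Nat.*-identityˡ m))
                                          (Nat.≤-trans (m≤c a) (Nat.≤-reflexive (≡.sym (Nat.*-identityʳ c))))
    indicator-*-≤ (no _) _ = z≤n

  module _ {A B : Set} where

    indicator-cong : (A → B) → (B → A) → (a : Dec A) (b : Dec B) → indicator a ≡ indicator b
    indicator-cong A⇒B B⇒A (yes _) (yes _) = ≡.refl
    indicator-cong A⇒B B⇒A (yes a) (no ¬b) = contradiction (A⇒B a) ¬b
    indicator-cong A⇒B B⇒A (no ¬a) (yes b) = contradiction (B⇒A b) ¬a
    indicator-cong A⇒B B⇒A (no _)  (no _)  = ≡.refl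

    indicator-mono : (A → B) → (a : Dec A) (b : Dec B) → indicator a ≤ indicator b
    indicator-mono A⇒B (yes a) (no ¬b) = contradiction (A⇒B a) ¬b
    indicator-mono A⇒B (yes _) (yes _) = Nat.≤-refl
    indicator-mono A⇒B (no _)  _       = z≤n

    indicator-× : (a : Dec A) (b : Dec B) → indicator (a ×-dec b) ≡ indicator a * indicator b
    indicator-× (yes _) (yes _) = ≡.refl
    indicator-× (yes _) (no _)  = ≡.refl
    indicator-× (no _)  _       = ≡.refl

    indicator-⊎ : ¬ (A × B) → (a : Dec A) (b : Dec B) → indicator (a ⊎-dec b) ≡ indicator a + indicator b
    indicator-⊎ ¬A×B (yes a) (yes b) = contradiction (a , b) ¬A×B
    indicator-⊎ ¬A×B (yes _) (no _)  = ≡.refl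
    indicator-⊎ ¬A×B (no _)  (yes _) = ≡.refl
    indicator-⊎ ¬A×B (no _)  (no _)  = ≡.refl

  select : ∀ {k} {R : Pred (Fin k) 0ℓ} (R? : Decidable R) →
    Σ (Fin (∑[ i < k ] indicator (R? i)) → Fin k) λ g →
      (∀ i → R (g i)) × (∀ i j → g i ≡ g j → i ≡ j) × (∀ j → R j → ∃ λ i → g i ≡ j)
  select {zero} R? = (λ ()) , (λ ()) , (λ ()) , (λ ())
  select {suc k} {R} R? with R? zero | select (R? ∘ suc)
  ... | yes r | g , gR , g-inj , g-onto = g′ , g′R , g′-inj , g′-onto
    where
    g′ : Fin (suc (∑[ i < k ] indicator (R? (suc i)))) → Fin (suc k)
    g′ zero    = zero
    g′ (suc i) = suc (g i)
    g′R : ∀ i → R (g′ i)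
    g′R zero    = r
    g′R (suc i) = gR i
    g′-inj : ∀ i j → g′ i ≡ g′ j → i ≡ j
    g′-inj zero    zero    _  = ≡.refl
    g′-inj (suc i) (suc j) eq = ≡.cong suc (g-inj i j (suc-injective eq))
    g′-onto : ∀ j → R j → ∃ λ i → g′ i ≡ j
    g′-onto zero    _  = zero , ≡.refl
    g′-onto (suc j) Rj with g-onto j Rj
    ... | i , eq = suc i , ≡.cong suc eq
  ... | no ¬r | g , gR , g-inj , g-onto = suc ∘ g , gR , (λ i j → g-inj i j ∘ suc-injective) , g′-onto
    where
    g′-onto : ∀ j → R j → ∃ λ i → suc (g i) ≡ j
    g′-onto zero    r  = contradiction r ¬r
    g′-onto (suc j) Rj with g-onto j Rj
    ... | i , eq = i , ≡.cong suc eq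

module Counting (A : Setoid 0ℓ 0ℓ) {n : ℕ} (enum : Fin n → Setoid.Carrier A)
  (enum-inj : ∀ i j → Setoid._≈_ A (enum i) (enum j) → i ≡ j)
  (enum-onto : ∀ x → ∃ λ i → Setoid._≈_ A (enum i) x) where

  open Setoid A

  open import Data.Nat using (_+_; _*_)

  private variable P Q : Pred Carrier 0ℓ

  index : Carrier → Fin n
  index x = proj₁ (enum-onto x)

  enum-index : ∀ x → enum (index x) ≈ x
  enum-index x = proj₂ (enum-onto x)

  infix 4 _≟_
  _≟_ : ∀ x y → Dec (x ≈ y)
  x ≟ y with index x Fin.≟ index y
  ... | yes eq = yes (trans (sym (enum-index x)) (trans (reflexive (≡.cong enum eq)) (enum-index y)))
  ... | no ne  = no λ x≈y → ne (enum-inj _ _ (trans (enum-index x) (trans x≈y (sym (enum-index y)))))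

  χ : Decidable P → Fin n → ℕ
  χ P? i = indicator (P? (enum i))

  count : Decidable P → ℕ
  count P? = sum (χ P?)

  Enumeration : Pred Carrier 0ℓ → ℕ → Set
  Enumeration P k = Σ (Fin k → Carrier) λ e →
    (∀ i → P (e i)) × (∀ i j → e i ≈ e j → i ≡ j) × (∀ x → P x → ∃ λ i → e i ≈ x)

  enumeration : P Respects _≈_ → (P? : Decidable P) → Enumeration P (count P?)
  enumeration {P} P-resp P? with select (P? ∘ enum)
  ... | g , gP , g-inj , g-onto = enum ∘ g , gP , (λ i j → g-inj i j ∘ enum-inj _ _) , onto
    where
    onto : ∀ x → P x → ∃ λ i → enum (g i) ≈ x
    onto x Px with g-onto (index x) (P-resp (sym (enum-index x)) Px)
    ... | i , eq = i , trans (reflexive (≡.cong enum eq)) (enum-index x)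

  module _ (P? : Decidable P) (Q? : Decidable Q) where

    count-cong : P ⊆ Q → Q ⊆ P → count P? ≡ count Q?
    count-cong P⊆Q Q⊆P = sum-cong-≗ {n} λ i → indicator-cong P⊆Q Q⊆P (P? (enum i)) (Q? (enum i))

    count-mono : P ⊆ Q → count P? ≤ count Q?
    count-mono P⊆Q = ∑-mono-≤ λ i → indicator-mono P⊆Q (P? (enum i)) (Q? (enum i))

    count-⊎ : (∀ {x} → ¬ (P x × Q x)) → count (λ x → P? x ⊎-dec Q? x) ≡ count P? + count Q?
    count-⊎ disjoint = ≡.trans (sum-cong-≗ {n} λ i → indicator-⊎ disjoint (P? (enum i)) (Q? (enum i)))
                                (∑-distrib-+ (χ P?) (χ Q?))

  count-U : count U? ≡ n
  count-U = ∑-ones n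

  count-∁ : (P? : Decidable P) → count P? + count (∁? P?) ≡ n
  count-∁ P? = ≡.trans (≡.sym (count-⊎ P? (∁? P?) λ (p , ¬p) → ¬p p))
                       (≡.trans (count-cong (λ x → P? x ⊎-dec ∁? P? x) U? (λ _ → tt) (λ {x} _ → toSum (P? x)))
                                count-U)

  count-singleton : ∀ a → count (_≟ a) ≡ 1
  count-singleton a = ∑-single _ (index a) hit miss
    where
    hit : indicator (enum (index a) ≟ a) ≡ 1
    hit with enum (index a) ≟ a
    ... | yes _ = ≡.refl
    ... | no ¬e = contradiction (enum-index a) ¬e
    miss : ∀ i → i ≢ index a → indicator (enum i ≟ a) ≡ 0
    miss i i≢a with enum i ≟ a
    ... | yes e = contradiction (enum-inj _ _ (trans e (sym (enum-index a)))) i≢a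
    ... | no _  = ≡.refl

  count-positive : (P? : Decidable P) → 0 < count P? → ∃ P
  count-positive P? pos with ∑-positive _ pos
  ... | i , 0<ind = enum i , indicator-positive (P? (enum i)) 0<ind

  fibre? : Decidable P → (f : Carrier → Carrier) → ∀ y → Decidable (λ x → P x × y ≈ f x)
  fibre? P? f y x = P? x ×-dec (y ≟ f x)

  fibreSize : Decidable P → (Carrier → Carrier) → Carrier → ℕ
  fibreSize P? f y = count (fibre? P? f y)

  fibreSize-cong : (P? : Decidable P) (f : Carrier → Carrier) → ∀ {y y′} → y ≈ y′ →
                   fibreSize P? f y ≡ fibreSize P? f y′
  fibreSize-cong P? f y≈y′ = count-cong (fibre? P? f _) (fibre? P? f _)
    (λ (p , e) → p , trans (sym y≈y′) e) (λ (p , e) → p , trans y≈y′ e)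

  module _ {P Q : Pred Carrier 0ℓ} (P? : Decidable P) (Q? : Decidable Q) (f : Carrier → Carrier)
           (f-maps : ∀ {x} → P x → Q (f x)) (Q-resp : Q Respects _≈_) where

    count-by-fibres : count P? ≡ ∑[ j < n ] (χ Q? j * fibreSize P? f (enum j))
    count-by-fibres = begin
      sum (χ P?)
        ≡⟨ sum-cong-≗ {n} (λ i → ≡.trans (≡.cong (χ P? i *_) (count-singleton (f (enum i)))) (Nat.*-identityʳ _)) ⟨
      ∑[ i < n ] (χ P? i * count (_≟ f (enum i)))
        ≡⟨ sum-cong-≗ {n} (λ i → *-distribˡ-sum (χ P? i) (χ (_≟ f (enum i)))) ⟩
      ∑[ i < n ] ∑[ j < n ] (χ P? i * χ (_≟ f (enum i)) j)
        ≡⟨ sum-cong-≗ {n} (λ i → sum-cong-≗ {n} (λ j → weights-swap (enum i) (enum j))) ⟩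
      ∑[ i < n ] ∑[ j < n ] (χ Q? j * χ (fibre? P? f (enum j)) i)
        ≡⟨ ∑-comm (λ i j → χ Q? j * χ (fibre? P? f (enum j)) i) ⟩
      ∑[ j < n ] ∑[ i < n ] (χ Q? j * χ (fibre? P? f (enum j)) i)
        ≡⟨ sum-cong-≗ {n} (λ j → *-distribˡ-sum (χ Q? j) (χ (fibre? P? f (enum j)))) ⟨
      ∑[ j < n ] (χ Q? j * fibreSize P? f (enum j)) ∎
      where
      open ≡.≡-Reasoning
      weights-swap : ∀ x y → indicator (P? x) * indicator (y ≟ f x) ≡ indicator (Q? y) * indicator (fibre? P? f y x)
      weights-swap x y = begin
        indicator (P? x) * indicator (y ≟ f x)          ≡⟨ indicator-× (P? x) (y ≟ f x) ⟨
        indicator (fibre? P? f y x)                       ≡⟨ indicator-cong (λ p → Q-resp (sym (proj₂ p)) (f-maps (proj₁ p)) , p)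
                                                               proj₂ (fibre? P? f y x) (Q? y ×-dec fibre? P? f y x) ⟩
        indicator (Q? y ×-dec fibre? P? f y x)           ≡⟨ indicator-× (Q? y) (fibre? P? f y x) ⟩
        indicator (Q? y) * indicator (fibre? P? f y x)  ∎

    count-fibres-≡ : ∀ c → (∀ {y} → Q y → fibreSize P? f y ≡ c) → count P? ≡ c * count Q?
    count-fibres-≡ c fibres≡c = begin
      count P?                                       ≡⟨ count-by-fibres ⟩
      ∑[ j < n ] (χ Q? j * fibreSize P? f (enum j))  ≡⟨ sum-cong-≗ {n} (λ j → indicator-*-≡ (Q? (enum j)) (fibres≡c {enum j})) ⟩
      ∑[ j < n ] (c * χ Q? j)                        ≡⟨ *-distribˡ-sum c (χ Q?) ⟨
      c * count Q?                                   ∎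
      where open ≡.≡-Reasoning

    count-fibres-≤ : ∀ c → (∀ {y} → Q y → fibreSize P? f y ≤ c) → count P? ≤ c * count Q?
    count-fibres-≤ c fibres≤c = begin
      count P?                                       ≡⟨ count-by-fibres ⟩
      ∑[ j < n ] (χ Q? j * fibreSize P? f (enum j))  ≤⟨ ∑-mono-≤ (λ j → indicator-*-≤ (Q? (enum j)) (fibres≤c {enum j})) ⟩
      ∑[ j < n ] (c * χ Q? j)                        ≡⟨ *-distribˡ-sum c (χ Q?) ⟨
      c * count Q?                                   ∎
      where open Nat.≤-Reasoning

    fibres-full : ∀ c → (∀ {y} → Q y → fibreSize P? f y ≤ c) → count P? ≡ c * count Q? →
                  ∀ {y} → Q y → fibreSize P? f y ≡ c
    fibres-full c fibres≤c |P|≡c|Q| {y} Qy = ≡.trans (fibreSize-cong P? f (sym (enum-index y))) (at-index (Q? y′) pointwise)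
      where
      y′ = enum (index y)
      pointwise : indicator (Q? y′) * fibreSize P? f y′ ≡ c * indicator (Q? y′)
      pointwise = ∑-≤-≡ (λ j → indicator-*-≤ (Q? (enum j)) (fibres≤c {enum j}))
        (≡.trans (≡.sym count-by-fibres) (≡.trans |P|≡c|Q| (*-distribˡ-sum c (χ Q?)))) (index y)
      at-index : (d : Dec (Q y′)) → indicator d * fibreSize P? f y′ ≡ c * indicator d → fibreSize P? f y′ ≡ c
      at-index (yes _)  eq = ≡.trans (≡.sym (Nat.*-identityˡ _)) (≡.trans eq (Nat.*-identityʳ c))
      at-index (no ¬Qy′) _  = contradiction (Q-resp (sym (enum-index y)) Qy) ¬Qy′

module PowersAndSums {n : ℕ} (F : FiniteField n) (s : ℕ) where
  open FiniteField F hiding (zero)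
  open FieldNotions F s using (pow; sumTo)
  private
    module Exp = Algebra.Properties.CommutativeSemiring.Exp commutativeSemiring
    module +ᶜ = Algebra.Properties.CommutativeSemigroup +-commutativeSemigroup

  pow≡^ : ∀ x k → pow x k ≡ x Exp.^ k
  pow≡^ x zero    = ≡.refl
  pow≡^ x (suc k) = ≡.cong (x *_) (pow≡^ x k)

  pow-cong : ∀ {x y} k → x ≈ y → pow x k ≈ pow y k
  pow-cong {x} {y} k x≈y rewrite pow≡^ x k | pow≡^ y k = Exp.^-congˡ k x≈y

  pow-+ : ∀ x a b → pow x (a Nat.+ b) ≈ pow x a * pow x b
  pow-+ x a b rewrite pow≡^ x (a Nat.+ b) | pow≡^ x a | pow≡^ x b = Exp.^-homo-* x a b

  pow-* : ∀ x a b → pow x (a Nat.* b) ≈ pow (pow x a) b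
  pow-* x a b rewrite pow≡^ x (a Nat.* b) | pow≡^ (pow x a) b | pow≡^ x a = sym (Exp.^-assocʳ x a b)

  pow-distrib-* : ∀ x y k → pow (x * y) k ≈ pow x k * pow y k
  pow-distrib-* x y k rewrite pow≡^ (x * y) k | pow≡^ x k | pow≡^ y k = Exp.^-distrib-* x y k

  pow-1# : ∀ k → pow 1# k ≈ 1#
  pow-1# zero    = refl
  pow-1# (suc k) = trans (*-identityˡ _) (pow-1# k)

  pow-2^-suc : ∀ x i → pow x (2 ^ suc i) ≈ pow x (2 ^ i) * pow x (2 ^ i)
  pow-2^-suc x i = trans (pow-+ x (2 ^ i) (2 ^ i Nat.+ 0)) (*-congˡ (reflexive (≡.cong (pow x) (Nat.+-identityʳ (2 ^ i)))))

  sumTo-cong : ∀ k {f g : ℕ → Carrier} → (∀ i → f i ≈ g i) → sumTo k f ≈ sumTo k g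
  sumTo-cong zero    f≈g = refl
  sumTo-cong (suc k) f≈g = +-cong (sumTo-cong k f≈g) (f≈g k)

  sumTo-+ : ∀ k (f g : ℕ → Carrier) → sumTo k (λ i → f i + g i) ≈ sumTo k f + sumTo k g
  sumTo-+ zero    f g = sym (+-identityʳ 0#)
  sumTo-+ (suc k) f g = trans (+-congʳ (sumTo-+ k f g)) (+ᶜ.interchange (sumTo k f) (sumTo k g) (f k) (g k))

  sumTo-split : ∀ a b (f : ℕ → Carrier) → sumTo (a Nat.+ b) f ≈ sumTo a f + sumTo b (λ i → f (a Nat.+ i))
  sumTo-split a zero    f = trans (reflexive (≡.cong (λ k → sumTo k f) (Nat.+-identityʳ a))) (sym (+-identityʳ _))
  sumTo-split a (suc b) f rewrite Nat.+-suc a b = trans (+-congʳ (sumTo-split a b f)) (+-assoc _ _ _)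

module FiniteFieldProperties {n : ℕ} (F : FiniteField n) (s : ℕ) where
  open FiniteField F hiding (zero)
  open FieldNotions F s using (pow; q; InFq)
  open PowersAndSums F s
  open Counting setoid enum enum-inj enum-sur
  open Algebra.Properties.CommutativeMonoid.Sum *-commutativeMonoid
    using () renaming (sum to ∏; sum-permute to ∏-permute; sum-cong-≋ to ∏-cong; ∑-distrib-+ to ∏-distrib-*)
  open ≈-Reasoning setoid

  _⁻¹⟨_⟩ : ∀ x → ¬ x ≈ 0# → Carrier
  x ⁻¹⟨ x≉0 ⟩ = proj₁ (inverse x x≉0)

  *-inverseʳ : ∀ x (x≉0 : ¬ x ≈ 0#) → x * x ⁻¹⟨ x≉0 ⟩ ≈ 1#
  *-inverseʳ x x≉0 = proj₂ (inverse x x≉0)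

  *-inverseˡ : ∀ x (x≉0 : ¬ x ≈ 0#) → x ⁻¹⟨ x≉0 ⟩ * x ≈ 1#
  *-inverseˡ x x≉0 = trans (*-comm _ x) (*-inverseʳ x x≉0)

  *-cancelˡ : ∀ x {a b} → ¬ x ≈ 0# → x * a ≈ x * b → a ≈ b
  *-cancelˡ x {a} {b} x≉0 xa≈xb = begin
    a                     ≈⟨ *-identityˡ a ⟨
    1# * a                ≈⟨ *-congʳ (*-inverseˡ x x≉0) ⟨
    x ⁻¹⟨ x≉0 ⟩ * x * a   ≈⟨ *-assoc _ x a ⟩
    x ⁻¹⟨ x≉0 ⟩ * (x * a) ≈⟨ *-congˡ xa≈xb ⟩
    x ⁻¹⟨ x≉0 ⟩ * (x * b) ≈⟨ *-assoc _ x b ⟨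
    x ⁻¹⟨ x≉0 ⟩ * x * b   ≈⟨ *-congʳ (*-inverseˡ x x≉0) ⟩
    1# * b                ≈⟨ *-identityˡ b ⟩
    b                     ∎

  x*y≈0⇒x≈0∨y≈0 : ∀ x y → x * y ≈ 0# → x ≈ 0# ⊎ y ≈ 0#
  x*y≈0⇒x≈0∨y≈0 x y xy≈0 with x ≟ 0#
  ... | yes x≈0 = inj₁ x≈0
  ... | no  x≉0 = inj₂ (*-cancelˡ x x≉0 (trans xy≈0 (sym (zeroʳ x))))

  ∏-pow : ∀ {k} x (g : Fin k → ℕ) → ∏ (λ i → pow x (g i)) ≈ pow x (sum g)
  ∏-pow {zero}  x g = refl
  ∏-pow {suc k} x g = trans (*-congˡ (∏-pow x (g ∘ suc))) (sym (pow-+ x (g zero) _))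

  ∏-≉0 : ∀ {k} (f : Fin k → Carrier) → (∀ i → ¬ f i ≈ 0#) → ¬ ∏ f ≈ 0#
  ∏-≉0 {zero}  f f≉0 = 1≉0
  ∏-≉0 {suc k} f f≉0 ∏f≈0 with x*y≈0⇒x≈0∨y≈0 _ _ ∏f≈0
  ... | inj₁ f₀≈0 = f≉0 zero f₀≈0
  ... | inj₂ ∏≈0  = ∏-≉0 (f ∘ suc) (f≉0 ∘ suc) ∏≈0

  nonzero? : Decidable (λ x → ¬ x ≈ 0#)
  nonzero? = ∁? (_≟ 0#)

  order≡suc : n ≡ suc (count nonzero?)
  order≡suc = ≡.trans (≡.sym (count-∁ (_≟ 0#))) (≡.cong (Nat._+ count nonzero?) (count-singleton 0#))

  private
    orOne : ∀ x → Dec (x ≈ 0#) → Carrier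
    orOne x (yes _) = 1#
    orOne x (no _)  = x

    orOne-cong : ∀ {x y} → x ≈ y → (d : Dec (x ≈ 0#)) (d′ : Dec (y ≈ 0#)) → orOne x d ≈ orOne y d′
    orOne-cong x≈y (yes _)   (yes _)   = refl
    orOne-cong x≈y (yes x≈0) (no y≉0)  = contradiction (trans (sym x≈y) x≈0) y≉0
    orOne-cong x≈y (no x≉0)  (yes y≈0) = contradiction (trans x≈y y≈0) x≉0
    orOne-cong x≈y (no _)    (no _)    = x≈y

    orOne-≉0 : ∀ x (d : Dec (x ≈ 0#)) → ¬ orOne x d ≈ 0#
    orOne-≉0 x (yes _)  = 1≉0
    orOne-≉0 x (no x≉0) = x≉0

    orOne-* : ∀ {a} x → ¬ a ≈ 0# → (d : Dec (x ≈ 0#)) (d′ : Dec (a * x ≈ 0#)) →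
              orOne (a * x) d′ ≈ pow a (indicator (¬? d)) * orOne x d
    orOne-* x a≉0 (yes _)   (yes _)    = sym (*-identityˡ 1#)
    orOne-* x a≉0 (yes x≈0) (no ax≉0)  = contradiction (trans (*-congˡ x≈0) (zeroʳ _)) ax≉0
    orOne-* x a≉0 (no x≉0)  (yes ax≈0) = ⊥-elim ([ a≉0 , x≉0 ]′ (x*y≈0⇒x≈0∨y≈0 _ x ax≈0))
    orOne-* x a≉0 (no _)    (no _)     = *-congʳ (sym (*-identityʳ _))

  -- Multiplication by a permutes the field, so the product P of all elements (with 0 replaced by 1)
  -- satisfies P ≈ a ^ m · P, where m counts the nonzero elements.
  pow-count-nonzero : ∀ a → ¬ a ≈ 0# → pow a (count nonzero?) ≈ 1#
  pow-count-nonzero a a≉0 = sym (*-cancelˡ P P≉0 (begin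
    P * 1#                        ≈⟨ *-identityʳ P ⟩
    P                             ≈⟨ ∏-permute (ψ ∘ enum) π ⟩
    ∏ (λ i → ψ (enum (π ⟨$⟩ʳ i))) ≈⟨ ∏-cong {n} (λ i → ψ-a* (enum i)) ⟩
    ∏ (λ i → pow a (χ nonzero? i) * ψ (enum i)) ≈⟨ ∏-distrib-* (pow a ∘ χ nonzero?) (ψ ∘ enum) ⟩
    ∏ (λ i → pow a (χ nonzero? i)) * P          ≈⟨ *-congʳ (∏-pow a (χ nonzero?)) ⟩
    pow a (count nonzero?) * P    ≈⟨ *-comm _ P ⟩
    P * pow a (count nonzero?)    ∎))
    where
    ψ : Carrier → Carrier
    ψ x = orOne x (x ≟ 0#)
    P : Carrier
    P = ∏ (ψ ∘ enum)
    ψ-a* : ∀ x → ψ (enum (index (a * x))) ≈ pow a (indicator (nonzero? x)) * ψ x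
    ψ-a* x = trans (orOne-cong (enum-index (a * x)) (enum (index (a * x)) ≟ 0#) (a * x ≟ 0#))
                   (orOne-* x a≉0 (x ≟ 0#) (a * x ≟ 0#))
    P≉0 : ¬ P ≈ 0#
    P≉0 = ∏-≉0 (ψ ∘ enum) (λ i → orOne-≉0 (enum i) (enum i ≟ 0#))
    a⁻¹ = a ⁻¹⟨ a≉0 ⟩
    a*a⁻¹* : ∀ x → a * (a⁻¹ * x) ≈ x
    a*a⁻¹* x = trans (sym (*-assoc a a⁻¹ x)) (trans (*-congʳ (*-inverseʳ a a≉0)) (*-identityˡ x))
    a⁻¹*a* : ∀ x → a⁻¹ * (a * x) ≈ x
    a⁻¹*a* x = trans (sym (*-assoc a⁻¹ a x)) (trans (*-congʳ (*-inverseˡ a a≉0)) (*-identityˡ x))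
    π : Permutation n n
    π = permutation (λ i → index (a * enum i)) (λ i → index (a⁻¹ * enum i))
      (λ j → enum-inj _ _ (trans (enum-index _) (trans (*-congˡ (enum-index _)) (a*a⁻¹* (enum j)))))
      (λ j → enum-inj _ _ (trans (enum-index _) (trans (*-congˡ (enum-index _)) (a⁻¹*a* (enum j)))))

  pow-order : ∀ x → pow x n ≈ x
  pow-order x = trans (reflexive (≡.cong (pow x) order≡suc)) (x*pow-count-nonzero (x ≟ 0#))
    where
    x*pow-count-nonzero : Dec (x ≈ 0#) → x * pow x (count nonzero?) ≈ x
    x*pow-count-nonzero (yes x≈0) = trans (*-congʳ x≈0) (trans (zeroˡ _) (sym x≈0))
    x*pow-count-nonzero (no x≉0)  = trans (*-congˡ (pow-count-nonzero x x≉0)) (*-identityʳ x)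

  even-order⇒1+1≈0 : ∀ {k} → n ≡ 2 Nat.* k → 1# + 1# ≈ 0#
  even-order⇒1+1≈0 {k} n≡2k = begin
    1# + 1#   ≈⟨ +-congˡ -1≈1 ⟨
    1# - 1#   ≈⟨ -‿inverseʳ 1# ⟩
    0#        ∎
    where
    open Algebra.Properties.Ring ring using (-1*x≈-x; -‿involutive)
    -1≈1 : - 1# ≈ 1#
    -1≈1 = begin
      - 1#                  ≈⟨ pow-order (- 1#) ⟨
      pow (- 1#) n          ≡⟨ ≡.cong (pow (- 1#)) n≡2k ⟩
      pow (- 1#) (2 Nat.* k)  ≈⟨ pow-* (- 1#) 2 k ⟩
      pow (pow (- 1#) 2) k  ≈⟨ pow-cong k (trans (*-congˡ (*-identityʳ _)) (trans (-1*x≈-x (- 1#)) (-‿involutive 1#))) ⟩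
      pow 1# k              ≈⟨ pow-1# k ⟩
      1#                    ∎

  InFq-resp : InFq Respects _≈_
  InFq-resp x≈y x^q≈x = trans (pow-cong q (sym x≈y)) (trans x^q≈x x≈y)

  InFq? : Decidable InFq
  InFq? x = pow x q ≟ x

  InFq-* : ∀ {a b} → InFq a → InFq b → InFq (a * b)
  InFq-* {a} {b} a^q≈a b^q≈b = trans (pow-distrib-* a b q) (*-cong a^q≈a b^q≈b)

  InFq-⁻¹ : ∀ {a} → InFq a → (a≉0 : ¬ a ≈ 0#) → InFq (a ⁻¹⟨ a≉0 ⟩)
  InFq-⁻¹ {a} a^q≈a a≉0 = *-cancelˡ a a≉0 (begin
    a * pow a⁻¹ q        ≈⟨ *-congʳ a^q≈a ⟨
    pow a q * pow a⁻¹ q  ≈⟨ pow-distrib-* a a⁻¹ q ⟨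
    pow (a * a⁻¹) q      ≈⟨ pow-cong q (*-inverseʳ a a≉0) ⟩
    pow 1# q             ≈⟨ pow-1# q ⟩
    1#                   ≈⟨ *-inverseʳ a a≉0 ⟨
    a * a⁻¹              ∎)
    where a⁻¹ = a ⁻¹⟨ a≉0 ⟩

module Polynomials {n : ℕ} (F : FiniteField n) (s : ℕ) where
  open FiniteField F hiding (zero)
  open FieldNotions F s using (pow; sumTo)
  open FiniteFieldProperties F s using (*-cancelˡ)
  open Counting setoid enum enum-inj enum-sur using (_≟_)
  open Algebra.Solver.Ring.NaturalCoefficients.Default commutativeSemiring using (solve; _:=_; _:+_; _:*_)
  private module +ᶜ = Algebra.Properties.CommutativeSemigroup +-commutativeSemigroup
  open ≈-Reasoning setoid

  -- Horner form: PolyBelow d f says that f is a polynomial function of degree < d,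
  -- Monic d f that it is a monic polynomial function of degree d.
  PolyBelow : ℕ → (Carrier → Carrier) → Set
  PolyBelow zero    f = ∀ x → f x ≈ 0#
  PolyBelow (suc d) f = ∃ λ c → ∃ λ g → PolyBelow d g × (∀ x → f x ≈ c + x * g x)

  Monic : ℕ → (Carrier → Carrier) → Set
  Monic zero    f = ∀ x → f x ≈ 1#
  Monic (suc d) f = ∃ λ c → ∃ λ g → Monic d g × (∀ x → f x ≈ c + x * g x)

  private variable
    d e : ℕ
    f g : Carrier → Carrier

  monic-cong : Monic d f → (∀ x → g x ≈ f x) → Monic d g
  monic-cong {zero}  f≈1               g≈f x = trans (g≈f x) (f≈1 x)
  monic-cong {suc d} (c , h , hm , f≈) g≈f   = c , h , hm , λ x → trans (g≈f x) (f≈ x)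

  private
    ≈+x*0 : ∀ c x → c ≈ c + x * 0#
    ≈+x*0 c x = sym (trans (+-congˡ (zeroʳ x)) (+-identityʳ c))

  polyBelow-weaken : d ≤ e → PolyBelow d f → PolyBelow e f
  polyBelow-weaken {zero}  {zero}  _         f≈0 = f≈0
  polyBelow-weaken {zero}  {suc e} _         f≈0 =
    0# , (λ _ → 0#) , polyBelow-weaken z≤n (λ _ → refl) , λ x → trans (f≈0 x) (≈+x*0 0# x)
  polyBelow-weaken {suc d} {suc e} (s≤s d≤e) (c , h , hp , f≈) = c , h , polyBelow-weaken d≤e hp , f≈

  polyBelow-0# : PolyBelow d (λ _ → 0#)
  polyBelow-0# = polyBelow-weaken z≤n (λ _ → refl)

  polyBelow-const : ∀ c → PolyBelow (suc d) (λ _ → c)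
  polyBelow-const c = c , (λ _ → 0#) , polyBelow-0# , ≈+x*0 c

  monic⇒polyBelow : Monic d f → PolyBelow (suc d) f
  monic⇒polyBelow {zero}  f≈1               = 1# , (λ _ → 0#) , (λ _ → refl) , λ x → trans (f≈1 x) (≈+x*0 1# x)
  monic⇒polyBelow {suc d} (c , h , hm , f≈) = c , h , monic⇒polyBelow hm , f≈

  private
    horner-+ : ∀ {f f′ h h′ : Carrier → Carrier} {c c′} →
               (∀ x → f x ≈ c + x * h x) → (∀ x → f′ x ≈ c′ + x * h′ x) →
               ∀ x → f x + f′ x ≈ (c + c′) + x * (h x + h′ x)
    horner-+ {h = h} {h′} {c} {c′} f≈ f′≈ x = trans (+-cong (f≈ x) (f′≈ x))
      (solve 5 (λ c c′ x a b → (c :+ x :* a) :+ (c′ :+ x :* b) := (c :+ c′) :+ x :* (a :+ b)) refl c c′ x (h x) (h′ x))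

  polyBelow-+ : PolyBelow d f → PolyBelow d g → PolyBelow d (λ x → f x + g x)
  polyBelow-+ {zero}  f≈0 g≈0 x = trans (+-cong (f≈0 x) (g≈0 x)) (+-identityʳ 0#)
  polyBelow-+ {suc d} (c , h , hp , f≈) (c′ , h′ , hp′ , g≈) = c + c′ , _ , polyBelow-+ hp hp′ , horner-+ f≈ g≈

  monic-+ : Monic d f → PolyBelow d g → Monic d (λ x → f x + g x)
  monic-+ {zero}  f≈1 g≈0 x = trans (+-cong (f≈1 x) (g≈0 x)) (+-identityʳ 1#)
  monic-+ {suc d} (c , h , hm , f≈) (c′ , h′ , hp′ , g≈) = c + c′ , _ , monic-+ hm hp′ , horner-+ f≈ g≈

  monic-pow : ∀ d → Monic d (λ x → pow x d)
  monic-pow zero    x = refl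
  monic-pow (suc d) = 0# , (λ x → pow x d) , monic-pow d , λ x → sym (+-identityˡ _)

  polyBelow-pow : d < e → PolyBelow e (λ x → pow x d)
  polyBelow-pow {d} d<e = polyBelow-weaken d<e (monic⇒polyBelow (monic-pow d))

  polyBelow-sumTo : ∀ k (f : ℕ → Carrier → Carrier) → (∀ i → i < k → PolyBelow d (f i)) →
                    PolyBelow d (λ x → sumTo k (λ i → f i x))
  polyBelow-sumTo zero    f fp = polyBelow-0#
  polyBelow-sumTo (suc k) f fp = polyBelow-+ (polyBelow-sumTo k f (λ i i<k → fp i (Nat.m<n⇒m<1+n i<k))) (fp k Nat.≤-refl)

  -- f x − f a = (x − a) · h x, with the subtractions moved across
  monic-divide : Monic (suc d) f → ∀ a → ∃ λ h → Monic d h × (∀ x → f x + a * h x ≈ f a + x * h x)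
  monic-divide {zero} {f} (c , g , g≈1 , f≈) a = (λ _ → 1#) , (λ _ → refl) , λ x → begin
    f x + a * 1#            ≈⟨ +-congʳ (trans (f≈ x) (+-congˡ (*-congˡ (g≈1 x)))) ⟩
    (c + x * 1#) + a * 1#   ≈⟨ +ᶜ.xy∙z≈xz∙y c (x * 1#) (a * 1#) ⟩
    (c + a * 1#) + x * 1#   ≈⟨ +-congʳ (trans (f≈ a) (+-congˡ (*-congˡ (g≈1 a)))) ⟨
    f a + x * 1#            ∎
  monic-divide {suc d} {f} (c , g , gm , f≈) a with monic-divide gm a
  ... | k , km , g-divided = (λ x → g a + x * k x) , (g a , k , km , λ x → refl) , λ x → begin
    f x + a * (g a + x * k x)             ≈⟨ +-congʳ (f≈ x) ⟩
    (c + x * g x) + a * (g a + x * k x)   ≈⟨ solve 6 (λ c x a gx ga kx → (c :+ x :* gx) :+ a :* (ga :+ x :* kx)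
                                                    := (c :+ a :* ga) :+ x :* (gx :+ a :* kx)) refl c x a (g x) (g a) (k x) ⟩
    (c + a * g a) + x * (g x + a * k x)   ≈⟨ +-cong (sym (f≈ a)) (*-congˡ (g-divided x)) ⟩
    f a + x * (g a + x * k x)             ∎

  monic-roots≤degree : Monic d f → ∀ {k} (r : Fin k → Carrier) → (∀ i j → r i ≈ r j → i ≡ j) →
                       (∀ i → f (r i) ≈ 0#) → k ≤ d
  monic-roots≤degree fm {zero} r r-inj roots = z≤n
  monic-roots≤degree {zero} f≈1 {suc k} r r-inj roots = contradiction (trans (sym (f≈1 (r zero))) (roots zero)) 1≉0
  monic-roots≤degree {suc d} {f} fm {suc k} r r-inj roots with monic-divide fm (r zero)
  ... | h , hm , f-divided = s≤s (monic-roots≤degree hm (r ∘ suc) (λ i j → suc-injective ∘ r-inj (suc i) (suc j)) h-roots)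
    where
    a = r zero
    -- every other root b satisfies h b · (b − a) = 0 with b ≠ a
    h-roots : ∀ i → h (r (suc i)) ≈ 0#
    h-roots i with h (r (suc i)) ≟ 0#
    ... | yes hb≈0 = hb≈0
    ... | no  hb≉0 = contradiction (r-inj zero (suc i) (*-cancelˡ (h b) hb≉0 hb*a≈hb*b)) λ ()
      where
      b = r (suc i)
      hb*a≈hb*b : h b * a ≈ h b * b
      hb*a≈hb*b = begin
        h b * a         ≈⟨ *-comm _ a ⟩
        a * h b         ≈⟨ +-identityˡ _ ⟨
        0# + a * h b    ≈⟨ +-congʳ (roots (suc i)) ⟨
        f b + a * h b   ≈⟨ f-divided b ⟩
        f a + b * h b   ≈⟨ +-congʳ (roots zero) ⟩
        0# + b * h b    ≈⟨ +-identityˡ _ ⟩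
        b * h b         ≈⟨ *-comm b _ ⟩
        h b * b         ∎

CharacteristicTwo : ∀ {n} → FiniteField n → Set
CharacteristicTwo F = 1# + 1# ≈ 0#
  where open FiniteField F

module Characteristic2 {n : ℕ} (F : FiniteField n) (s : ℕ) (1+1≈0 : CharacteristicTwo F) where
  open FiniteField F hiding (zero)
  open FieldNotions F s
  open PowersAndSums F s
  open FiniteFieldProperties F s using (x*y≈0⇒x≈0∨y≈0)
  open Algebra.Properties.Ring ring using (+-inverseˡ-unique)
  open Algebra.Solver.Ring.NaturalCoefficients.Default commutativeSemiring using (solve; _:=_; _:+_; _:*_)
  private module +ᶜ = Algebra.Properties.CommutativeSemigroup +-commutativeSemigroup
  open ≈-Reasoning setoid

  x+x≈0 : ∀ x → x + x ≈ 0#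
  x+x≈0 x = begin
    x + x              ≈⟨ +-cong (*-identityʳ x) (*-identityʳ x) ⟨
    x * 1# + x * 1#    ≈⟨ distribˡ x 1# 1# ⟨
    x * (1# + 1#)      ≈⟨ *-congˡ 1+1≈0 ⟩
    x * 0#             ≈⟨ zeroʳ x ⟩
    0#                 ∎

  -x≈x : ∀ x → - x ≈ x
  -x≈x x = sym (+-inverseˡ-unique x x (x+x≈0 x))

  x-y≈x+y : ∀ x y → x - y ≈ x + y
  x-y≈x+y x y = +-congˡ (-x≈x y)

  x+y≈0⇒x≈y : ∀ {x y} → x + y ≈ 0# → x ≈ y
  x+y≈0⇒x≈y {x} {y} x+y≈0 = trans (+-inverseˡ-unique x y x+y≈0) (-x≈x y)

  x≈y⇒x+y≈0 : ∀ {x y} → x ≈ y → x + y ≈ 0#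
  x≈y⇒x+y≈0 {x} {y} x≈y = trans (+-congʳ x≈y) (x+x≈0 y)

  x+y≈z⇒x≈z+y : ∀ {x y z} → x + y ≈ z → x ≈ z + y
  x+y≈z⇒x≈z+y {x} {y} {z} x+y≈z = begin
    x              ≈⟨ +-identityʳ x ⟨
    x + 0#         ≈⟨ +-congˡ (x+x≈0 y) ⟨
    x + (y + y)    ≈⟨ +-assoc x y y ⟨
    (x + y) + y    ≈⟨ +-congʳ x+y≈z ⟩
    z + y          ∎

  x≉x+1 : ∀ x → ¬ x ≈ x + 1#
  x≉x+1 x x≈x+1 = 1≉0 (begin
    1#               ≈⟨ +-identityˡ 1# ⟨
    0# + 1#          ≈⟨ +-congʳ (x+x≈0 x) ⟨
    (x + x) + 1#     ≈⟨ +-assoc x x 1# ⟩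
    x + (x + 1#)     ≈⟨ x≈y⇒x+y≈0 x≈x+1 ⟩
    0#               ∎)

  x+[y+x]≈y : ∀ x y → x + (y + x) ≈ y
  x+[y+x]≈y x y = begin
    x + (y + x)   ≈⟨ +-congˡ (+-comm y x) ⟩
    x + (x + y)   ≈⟨ +-assoc x x y ⟨
    (x + x) + y   ≈⟨ +-congʳ (x+x≈0 x) ⟩
    0# + y        ≈⟨ +-identityˡ y ⟩
    y             ∎

  square-+ : ∀ x y → (x + y) * (x + y) ≈ x * x + y * y
  square-+ x y = begin
    (x + y) * (x + y)                  ≈⟨ solve 2 (λ x y → (x :+ y) :* (x :+ y) := (x :* x :+ y :* y) :+ (x :* y :+ x :* y))
                                                  refl x y ⟩
    (x * x + y * y) + (x * y + x * y)  ≈⟨ +-congˡ (x+x≈0 (x * y)) ⟩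
    (x * x + y * y) + 0#               ≈⟨ +-identityʳ _ ⟩
    x * x + y * y                      ∎

  pow-2^-+ : ∀ i x y → pow (x + y) (2 ^ i) ≈ pow x (2 ^ i) + pow y (2 ^ i)
  pow-2^-+ zero    x y = trans (*-identityʳ _) (sym (+-cong (*-identityʳ x) (*-identityʳ y)))
  pow-2^-+ (suc i) x y = begin
    pow (x + y) (2 ^ suc i)                                ≈⟨ pow-2^-suc (x + y) i ⟩
    pow (x + y) (2 ^ i) * pow (x + y) (2 ^ i)              ≈⟨ *-cong (pow-2^-+ i x y) (pow-2^-+ i x y) ⟩
    (pow x (2 ^ i) + pow y (2 ^ i)) * (pow x (2 ^ i) + pow y (2 ^ i))  ≈⟨ square-+ _ _ ⟩
    pow x (2 ^ i) * pow x (2 ^ i) + pow y (2 ^ i) * pow y (2 ^ i)      ≈⟨ +-cong (pow-2^-suc x i) (pow-2^-suc y i) ⟨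
    pow x (2 ^ suc i) + pow y (2 ^ suc i)                  ∎

  pow-2^-0# : ∀ i → pow 0# (2 ^ i) ≈ 0#
  pow-2^-0# zero    = zeroˡ 1#
  pow-2^-0# (suc i) = trans (pow-2^-suc 0# i) (trans (*-congʳ (pow-2^-0# i)) (zeroˡ _))

  pow-2^-sumTo : ∀ i k f → pow (sumTo k f) (2 ^ i) ≈ sumTo k (λ j → pow (f j) (2 ^ i))
  pow-2^-sumTo i zero    f = pow-2^-0# i
  pow-2^-sumTo i (suc k) f = trans (pow-2^-+ i _ _) (+-congʳ (pow-2^-sumTo i k f))

  sumTo-square : ∀ k f → sumTo k f * sumTo k f ≈ sumTo k (λ i → f i * f i)
  sumTo-square zero    f = zeroˡ 0#
  sumTo-square (suc k) f = trans (square-+ _ _) (+-congʳ (sumTo-square k f))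

  sumTo-telescope : ∀ k f → sumTo k (λ i → f (suc i)) + sumTo k f ≈ f k + f 0
  sumTo-telescope zero    f = trans (+-identityʳ 0#) (sym (x+x≈0 (f 0)))
  sumTo-telescope (suc k) f = begin
    (A + f (suc k)) + (B + f k)      ≈⟨ +ᶜ.interchange A (f (suc k)) B (f k) ⟩
    (A + B) + (f (suc k) + f k)      ≈⟨ +-congʳ (sumTo-telescope k f) ⟩
    (f k + f 0) + (f (suc k) + f k)  ≈⟨ solve 3 (λ a b c → (a :+ b) :+ (c :+ a) := (c :+ b) :+ (a :+ a))
                                                refl (f k) (f 0) (f (suc k)) ⟩
    (f (suc k) + f 0) + (f k + f k)  ≈⟨ +-congˡ (x+x≈0 (f k)) ⟩
    (f (suc k) + f 0) + 0#           ≈⟨ +-identityʳ _ ⟩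
    f (suc k) + f 0                  ∎
    where
    A = sumTo k (λ i → f (suc i))
    B = sumTo k f

  tr : Carrier → Carrier
  tr x = pow x q + x

  tr-cong : ∀ {x y} → x ≈ y → tr x ≈ tr y
  tr-cong x≈y = +-cong (pow-cong q x≈y) x≈y

  tr-+ : ∀ x y → tr (x + y) ≈ tr x + tr y
  tr-+ x y = trans (+-congʳ (pow-2^-+ s x y)) (+ᶜ.interchange (pow x q) (pow y q) x y)

  tr-* : ∀ {k} y → InFq k → tr (k * y) ≈ k * tr y
  tr-* {k} y k^q≈k = begin
    pow (k * y) q + k * y      ≈⟨ +-congʳ (trans (pow-distrib-* k y q) (*-congʳ k^q≈k)) ⟩
    k * pow y q + k * y        ≈⟨ distribˡ k (pow y q) y ⟨
    k * tr y                   ∎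

  tr-1# : tr 1# ≈ 0#
  tr-1# = x≈y⇒x+y≈0 (pow-1# q)

  G0≐InFq : G 0# ≐ InFq
  G0≐InFq x = x+y≈0⇒x≈y , x≈y⇒x+y≈0

  trq-cong : ∀ {x y} → x ≈ y → trq x ≈ trq y
  trq-cong x≈y = sumTo-cong s (λ i → pow-cong (2 ^ i) x≈y)

  trq-+ : ∀ x y → trq (x + y) ≈ trq x + trq y
  trq-+ x y = trans (sumTo-cong s (λ i → pow-2^-+ i x y)) (sumTo-+ s _ _)

  φ-cong : ∀ {x y} → x ≈ y → φ x ≈ φ y
  φ-cong x≈y = +-cong (*-cong x≈y x≈y) x≈y

  φ-+ : ∀ x y → φ (x + y) ≈ φ x + φ y
  φ-+ x y = trans (+-congʳ (square-+ x y)) (+ᶜ.interchange (x * x) (y * y) x y)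

  φ-kernel : ∀ {u} → φ u ≈ 0# → u ≈ 0# ⊎ u ≈ 1#
  φ-kernel {u} φu≈0 with x*y≈0⇒x≈0∨y≈0 u (u + 1#) (trans (distribˡ u u 1#) (trans (+-congˡ (*-identityʳ u)) φu≈0))
  ... | inj₁ u≈0   = inj₁ u≈0
  ... | inj₂ u+1≈0 = inj₂ (x+y≈0⇒x≈y u+1≈0)

  φx≈φy⇒x≈y∨x≈y+1 : ∀ {x y} → φ x ≈ φ y → x ≈ y ⊎ x ≈ y + 1#
  φx≈φy⇒x≈y∨x≈y+1 {x} {y} φx≈φy with φ-kernel (trans (φ-+ x y) (x≈y⇒x+y≈0 φx≈φy))
  ... | inj₁ x+y≈0 = inj₁ (x+y≈0⇒x≈y x+y≈0)
  ... | inj₂ x+y≈1 = inj₂ (trans (x+y≈z⇒x≈z+y x+y≈1) (+-comm 1# y))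

  φ-1# : φ 1# ≈ 0#
  φ-1# = trans (+-congʳ (*-identityʳ 1#)) 1+1≈0

  φ-+1 : ∀ x → φ (x + 1#) ≈ φ x
  φ-+1 x = trans (φ-+ x 1#) (trans (+-congˡ φ-1#) (+-identityʳ (φ x)))

  φ-trq : ∀ x → φ (trq x) ≈ tr x
  φ-trq x = begin
    trq x * trq x + trq x                                     ≈⟨ +-congʳ (sumTo-square s _) ⟩
    sumTo s (λ i → pow x (2 ^ i) * pow x (2 ^ i)) + trq x    ≈⟨ +-congʳ (sumTo-cong s (λ i → sym (pow-2^-suc x i))) ⟩
    sumTo s (λ i → pow x (2 ^ suc i)) + trq x                 ≈⟨ sumTo-telescope s (λ i → pow x (2 ^ i)) ⟩
    pow x q + x * 1#                                          ≈⟨ +-congˡ (*-identityʳ x) ⟩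
    tr x                                                      ∎

  trq-φ : ∀ x → trq (φ x) ≈ tr x
  trq-φ x = begin
    trq (x * x + x)                                           ≈⟨ trq-+ (x * x) x ⟩
    trq (x * x) + trq x                                       ≈⟨ +-congʳ (sumTo-cong s (λ i → pow-distrib-* x x (2 ^ i))) ⟩
    sumTo s (λ i → pow x (2 ^ i) * pow x (2 ^ i)) + trq x    ≈⟨ +-congʳ (sumTo-square s _) ⟨
    φ (trq x)                                                 ≈⟨ φ-trq x ⟩
    tr x                                                      ∎

  trq2≈trq+trq^q : ∀ x → trq2 x ≈ trq x + pow (trq x) q
  trq2≈trq+trq^q x = begin
    trq2 x                                                  ≈⟨ sumTo-split s (s Nat.+ 0) _ ⟩
    trq x + sumTo (s Nat.+ 0) shifted                       ≡⟨ ≡.cong (λ k → trq x + sumTo k shifted) (Nat.+-identityʳ s) ⟩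
    trq x + sumTo s shifted                                 ≈⟨ +-congˡ (sumTo-cong s shifted≈) ⟩
    trq x + sumTo s (λ i → pow (pow x (2 ^ i)) q)           ≈⟨ +-congˡ (pow-2^-sumTo s s _) ⟨
    trq x + pow (trq x) q                                   ∎
    where
    shifted : ℕ → Carrier
    shifted i = pow x (2 ^ (s Nat.+ i))
    shifted≈ : ∀ i → shifted i ≈ pow (pow x (2 ^ i)) q
    shifted≈ i = trans (reflexive (≡.cong (pow x) (≡.trans (Nat.^-distribˡ-+-* 2 s i) (Nat.*-comm q (2 ^ i)))))
                    (pow-* x (2 ^ i) q)

  isCoset-≐ : ∀ {H H′ P : Carrier → Set} {a} → H ≐ H′ → IsCoset H a P → IsCoset H′ a P
  isCoset-≐ H≐H′ P≐a+H x = proj₁ (H≐H′ _) ∘ proj₁ (P≐a+H x) , proj₂ (P≐a+H x) ∘ proj₂ (H≐H′ _)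

  module AdditiveFibres (f : Carrier → Carrier) (f-cong : ∀ {x y} → x ≈ y → f x ≈ f y)
                        (f-+ : ∀ x y → f (x + y) ≈ f x + f y) where

    Fibre : Carrier → Carrier → Set
    Fibre r x = f x ≈ r

    fibre-isCoset : ∀ {a r} → f a ≈ r → IsCoset (Fibre 0#) a (Fibre r)
    fibre-isCoset {a} {r} fa≈r x =
      (λ fx≈r → trans (f-cong (x-y≈x+y x a)) (trans (f-+ x a) (x≈y⇒x+y≈0 (trans fx≈r (sym fa≈r))))) ,
      (λ f[x-a]≈0 → trans (x+y≈0⇒x≈y (trans (sym (f-+ x a)) (trans (f-cong (sym (x-y≈x+y x a))) f[x-a]≈0))) fa≈r)

    fibre-⊕ : ∀ {a r} t → f a ≈ r → (Fibre r ⊕ Fibre t) ≐ Fibre (r + t)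
    fibre-⊕ {a} {r} t fa≈r x =
      (λ (y , z , fy≈r , fz≈t , x≈y+z) → trans (f-cong x≈y+z) (trans (f-+ y z) (+-cong fy≈r fz≈t))) ,
      (λ fx≈r+t → a , x + a , fa≈r ,
        trans (f-+ x a) (trans (+-cong fx≈r+t fa≈r) (trans (+-assoc r t r) (x+[y+x]≈y r t))) ,
        sym (x+[y+x]≈y a x))

module TraceMaps (s′ : ℕ) (F : FiniteField (2 ^ (2 Nat.* suc s′))) where
  open FiniteField F hiding (zero)
  open FieldNotions F (suc s′)
  open PowersAndSums F (suc s′)
  open FiniteFieldProperties F (suc s′)
  open Polynomials F (suc s′)
  open Counting setoid enum enum-inj enum-sur

  characteristicTwo : CharacteristicTwo F
  characteristicTwo = even-order⇒1+1≈0 {2 ^ (2 Nat.* suc s′ Nat.∸ 1)} ≡.refl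

  open Characteristic2 F (suc s′) characteristicTwo public

  order≡q*q : 2 ^ (2 Nat.* suc s′) ≡ q Nat.* q
  order≡q*q = ≡.trans (≡.cong (λ k → 2 ^ (suc s′ Nat.+ k)) (Nat.+-identityʳ (suc s′)))
                      (Nat.^-distribˡ-+-* 2 (suc s′) (suc s′))

  pow-q-q : ∀ x → pow (pow x q) q ≈ x
  pow-q-q x = trans (sym (pow-* x q q)) (trans (reflexive (≡.cong (pow x) (≡.sym order≡q*q))) (pow-order x))

  private
    module Gᶠ = AdditiveFibres tr tr-cong tr-+
    module Sᶠ = AdditiveFibres trq trq-cong trq-+

  InFq-tr : ∀ x → InFq (tr x)
  InFq-tr x = begin
    pow (pow x q + x) q        ≈⟨ pow-2^-+ (suc s′) (pow x q) x ⟩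
    pow (pow x q) q + pow x q  ≈⟨ +-congʳ (pow-q-q x) ⟩
    x + pow x q                ≈⟨ +-comm x (pow x q) ⟩
    tr x                       ∎
    where open ≈-Reasoning setoid

  1<q : 1 < q
  1<q = Nat.*-monoʳ-≤ 2 (Nat.m^n>0 2 s′)

  tr-monic : Monic q tr
  tr-monic = monic-+ (monic-pow q)
    (polyBelow-weaken 1<q (monic⇒polyBelow (monic-cong (monic-pow 1) (λ x → sym (*-identityʳ x)))))

  -- every element of F_q is a root of tr, which has degree q < q²
  ∃-outside-Fq : ∃ λ t → ¬ InFq t
  ∃-outside-Fq = Data.Product.map enum id (Fin.¬∀⟶∃¬ _ (InFq ∘ enum) (InFq? ∘ enum) all-in-Fq⇒⊥)
    where
    all-in-Fq⇒⊥ : ¬ (∀ i → InFq (enum i))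
    all-in-Fq⇒⊥ all-in-Fq = Nat.<⇒≱ (Nat.m<m*n q q {{Nat.m^n≢0 2 (suc s′)}} 1<q)
      (Nat.≤-trans (Nat.≤-reflexive (≡.sym order≡q*q))
        (monic-roots≤degree tr-monic enum enum-inj (λ i → x≈y⇒x+y≈0 (all-in-Fq i))))

  tr-onto : ∀ {r} → InFq r → ∃ λ x → tr x ≈ r
  tr-onto {r} r∈Fq with ∃-outside-Fq
  ... | t , t∉Fq = (r * c⁻¹) * t , (begin
    tr ((r * c⁻¹) * t)   ≈⟨ tr-* t (InFq-* r∈Fq (InFq-⁻¹ (InFq-tr t) c≉0)) ⟩
    (r * c⁻¹) * tr t     ≈⟨ *-assoc r c⁻¹ (tr t) ⟩
    r * (c⁻¹ * tr t)     ≈⟨ *-congˡ (*-inverseˡ (tr t) c≉0) ⟩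
    r * 1#               ≈⟨ *-identityʳ r ⟩
    r                    ∎)
    where
    open ≈-Reasoning setoid
    c≉0 : ¬ tr t ≈ 0#
    c≉0 = t∉Fq ∘ x+y≈0⇒x≈y
    c⁻¹ = tr t ⁻¹⟨ c≉0 ⟩

  G? : ∀ r → Decidable (G r)
  G? r x = tr x ≟ r

  S? : ∀ r → Decidable (S r)
  S? r x = trq x ≟ r

  S-resp : ∀ {r} → S r Respects _≈_
  S-resp x≈y trqx≈r = trans (trq-cong (sym x≈y)) trqx≈r

  G⊆InFq+ : ∀ {a r x} → tr a ≈ r → G r x → InFq (x + a)
  G⊆InFq+ {a} {r} {x} tra≈r trx≈r = x+y≈0⇒x≈y (trans (tr-+ x a) (x≈y⇒x+y≈0 (trans trx≈r (sym tra≈r))))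

  count-G≡count-InFq : ∀ {a r} → tr a ≈ r → count (G? r) ≡ count InFq?
  count-G≡count-InFq {a} {r} tra≈r =
    ≡.trans (count-fibres-≡ (G? r) InFq? (_+ a) (G⊆InFq+ tra≈r) InFq-resp 1 fibre≡1) (Nat.*-identityˡ _)
    where
    fibre≡1 : ∀ {k} → InFq k → fibreSize (G? r) (_+ a) k ≡ 1
    fibre≡1 {k} k∈Fq = ≡.trans (count-cong (fibre? (G? r) (_+ a) k) (_≟ k + a) to from) (count-singleton (k + a))
      where
      to : ∀ {x} → G r x × k ≈ x + a → x ≈ k + a
      to (_ , k≈x+a) = x+y≈z⇒x≈z+y (sym k≈x+a)
      from : ∀ {x} → x ≈ k + a → G r x × k ≈ x + a
      from x≈k+a = trans (tr-cong x≈k+a) (trans (tr-+ k a) (trans (+-cong (x≈y⇒x+y≈0 k∈Fq) tra≈r) (+-identityˡ r))) ,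
                   x+y≈z⇒x≈z+y (sym x≈k+a)

  -- the fibres of tr over F_q are translates of F_q, so the field has |F_q|² elements
  count-InFq : count InFq? ≡ q
  count-InFq = square-injective (≡.trans |K|²≡n order≡q*q)
    where
    |K|²≡n : count InFq? Nat.* count InFq? ≡ 2 ^ (2 Nat.* suc s′)
    |K|²≡n = ≡.trans (≡.sym (count-fibres-≡ U? InFq? tr (λ _ → InFq-tr _) InFq-resp _ fibre≡|K|)) count-U
      where
      fibre≡|K| : ∀ {y} → InFq y → fibreSize U? tr y ≡ count InFq?
      fibre≡|K| {y} y∈Fq = ≡.trans (count-cong (fibre? U? tr y) (G? y) (sym ∘ proj₂) (λ trx≈y → tt , sym trx≈y))
                                   (count-G≡count-InFq (proj₂ (tr-onto y∈Fq)))
    square-injective : ∀ {a b} → a Nat.* a ≡ b Nat.* b → a ≡ b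
    square-injective {a} {b} a²≡b² with Nat.<-cmp a b
    ... | tri< a<b _ _ = contradiction a²≡b² (Nat.<⇒≢ (Nat.*-mono-< a<b a<b))
    ... | tri≈ _ a≡b _ = a≡b
    ... | tri> _ _ b<a = contradiction (≡.sym a²≡b²) (Nat.<⇒≢ (Nat.*-mono-< b<a b<a))

  count-G : ∀ {r} → InFq r → count (G? r) ≡ q
  count-G r∈Fq = ≡.trans (count-G≡count-InFq (proj₂ (tr-onto r∈Fq))) count-InFq

  trq+r-monic : ∀ r → Monic (2 ^ s′) (λ x → trq x + r)
  trq+r-monic r = monic-cong (monic-+ (monic-pow (2 ^ s′)) (polyBelow-+ lower (polyBelow-weaken (Nat.m^n>0 2 s′) (polyBelow-const r))))
    (λ x → +ᶜ.xy∙z≈y∙xz (sumTo s′ (λ i → pow x (2 ^ i))) (pow x (2 ^ s′)) r)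
    where
    module +ᶜ = Algebra.Properties.CommutativeSemigroup +-commutativeSemigroup
    lower : PolyBelow (2 ^ s′) (λ x → sumTo s′ (λ i → pow x (2 ^ i)))
    lower = polyBelow-sumTo s′ (λ i x → pow x (2 ^ i)) (λ i i<s′ → polyBelow-pow (Nat.^-monoʳ-< 2 (s≤s (s≤s z≤n)) i<s′))

  count-S≤ : ∀ r → count (S? r) ≤ 2 ^ s′
  count-S≤ r with enumeration S-resp (S? r)
  ... | e , e∈S , e-inj , _ = monic-roots≤degree (trq+r-monic r) e e-inj (λ i → x≈y⇒x+y≈0 (e∈S i))

  count-pair : ∀ a → count (λ x → x ≟ a ⊎-dec x ≟ a + 1#) ≡ 2
  count-pair a = ≡.trans (count-⊎ (_≟ a) (_≟ a + 1#) (λ (x≈a , x≈a+1) → x≉x+1 a (trans (sym x≈a) x≈a+1)))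
                         (≡.cong₂ Nat._+_ (count-singleton a) (count-singleton (a + 1#)))

  φ-fibre≤2 : ∀ r y → fibreSize (G? r) φ y ≤ 2
  φ-fibre≤2 r y with 0 Nat.<? fibreSize (G? r) φ y
  ... | no ¬0<fibre = Nat.≤-trans (Nat.≮⇒≥ ¬0<fibre) z≤n
  ... | yes 0<fibre with count-positive (fibre? (G? r) φ y) 0<fibre
  ...   | x₁ , _ , y≈φx₁ = begin
    fibreSize (G? r) φ y                      ≤⟨ count-mono (fibre? (G? r) φ y) (λ x → x ≟ x₁ ⊎-dec x ≟ x₁ + 1#)
                                                   (λ (_ , y≈φx) → φx≈φy⇒x≈y∨x≈y+1 (trans (sym y≈φx) y≈φx₁)) ⟩
    count (λ x → x ≟ x₁ ⊎-dec x ≟ x₁ + 1#)   ≡⟨ count-pair x₁ ⟩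
    2                                         ∎
    where open Nat.≤-Reasoning

  G⇒S-φ : ∀ {r x} → G r x → S r (φ x)
  G⇒S-φ {r} {x} trx≈r = trans (trq-φ x) trx≈r

  count-S : ∀ {r} → InFq r → count (S? r) ≡ 2 ^ s′
  count-S {r} r∈Fq = Nat.≤-antisym (count-S≤ r) (Nat.*-cancelˡ-≤ 2 (begin
    q                 ≡⟨ count-G r∈Fq ⟨
    count (G? r)      ≤⟨ count-fibres-≤ (G? r) (S? r) φ G⇒S-φ S-resp 2 (λ {y} _ → φ-fibre≤2 r y) ⟩
    2 Nat.* count (S? r)  ∎))
    where open Nat.≤-Reasoning

  φ-fibre≡2 : ∀ {r y} → InFq r → S r y → fibreSize (G? r) φ y ≡ 2
  φ-fibre≡2 {r} r∈Fq = fibres-full (G? r) (S? r) φ G⇒S-φ S-resp 2 (λ {y} _ → φ-fibre≤2 r y)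
    (≡.trans (count-G r∈Fq) (≡.cong (2 Nat.*_) (≡.sym (count-S r∈Fq))))

  φ-onto : ∀ {r y} → InFq r → S r y → ∃ λ x → G r x × y ≈ φ x
  φ-onto {r} {y} r∈Fq y∈S = count-positive (fibre? (G? r) φ y) (≡.subst (0 <_) (≡.sym (φ-fibre≡2 r∈Fq y∈S)) (s≤s z≤n))

  S⇒G-φ : ∀ {r x} → S r x → G (φ r) x
  S⇒G-φ {r} {x} trqx≈r = trans (sym (φ-trq x)) (φ-cong trqx≈r)

  S⇒InFq : ∀ {r x} → φ r ≈ 0# → S r x → InFq x
  S⇒InFq φr≈0 x∈S = x+y≈0⇒x≈y (trans (S⇒G-φ x∈S) φr≈0)

  S0≐trace0 : S 0# ≐ (λ x → InFq x × trq x ≈ 0#)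
  S0≐trace0 x = (λ x∈S → S⇒InFq (trans (+-identityʳ _) (zeroˡ 0#)) x∈S , x∈S) , proj₂

  S1≐trace1 : S 1# ≐ (λ x → InFq x × trq x ≈ 1#)
  S1≐trace1 x = (λ x∈S → S⇒InFq φ-1# x∈S , x∈S) , proj₂

  G≐S∪S+1 : ∀ r → G (φ r) ≐ (λ x → S r x ⊎ S (r + 1#) x)
  G≐S∪S+1 r x = (λ trx≈φr → φx≈φy⇒x≈y∨x≈y+1 (trans (φ-trq x) trx≈φr)) ,
                λ { (inj₁ x∈Sr) → S⇒G-φ x∈Sr ; (inj₂ x∈Sr+1) → trans (S⇒G-φ x∈Sr+1) (φ-+1 r) }

  G-isCoset-at : ∀ {a r} → tr a ≈ r → IsCoset InFq a (G r)
  G-isCoset-at tra≈r = isCoset-≐ G0≐InFq (Gᶠ.fibre-isCoset tra≈r)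

  G-isCoset : ∀ r → InFq r → ∃ λ a → IsCoset InFq a (G r)
  G-isCoset r r∈Fq = proj₁ (tr-onto r∈Fq) , G-isCoset-at (proj₂ (tr-onto r∈Fq))

  coset-isG : ∀ a → ∃ λ r → InFq r × IsCoset InFq a (G r)
  coset-isG a = tr a , InFq-tr a , G-isCoset-at refl

  G⊕G : ∀ r t → InFq r → InFq t → (G r ⊕ G t) ≐ G (r + t)
  G⊕G r t r∈Fq _ = Gᶠ.fibre-⊕ t (proj₂ (tr-onto r∈Fq))

  G≐scaled-G1 : ∀ r → InFq r → ¬ r ≈ 0# → G r ≐ scaled r (G 1#)
  G≐scaled-G1 r r∈Fq r≉0 x =
    (λ trx≈r → r⁻¹ * x ,
      trans (tr-* x (InFq-⁻¹ r∈Fq r≉0)) (trans (*-congˡ trx≈r) (*-inverseˡ r r≉0)) ,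
      sym (trans (sym (*-assoc r r⁻¹ x)) (trans (*-congʳ (*-inverseʳ r r≉0)) (*-identityˡ x)))) ,
    (λ (y , try≈1 , x≈ry) → trans (tr-cong x≈ry) (trans (tr-* y r∈Fq) (trans (*-congˡ try≈1) (*-identityʳ r))))
    where r⁻¹ = r ⁻¹⟨ r≉0 ⟩

  φ-twoToOne : ∀ r → InFq r → TwoToOneOnto φ (G r) (S r)
  φ-twoToOne r r∈Fq = (λ _ → G⇒S-φ) , λ y y∈S →
    let (x₁ , x₁∈G , y≈φx₁) = φ-onto r∈Fq y∈S in
    x₁ , x₁ + 1# , x≉x+1 x₁ , x₁∈G , trans (tr-+ x₁ 1#) (trans (+-congˡ tr-1#) (trans (+-identityʳ _) x₁∈G)) ,
    sym y≈φx₁ , trans (φ-+1 x₁) (sym y≈φx₁) ,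
    λ x _ φx≈y → φx≈φy⇒x≈y∨x≈y+1 (trans φx≈y y≈φx₁)

  S-size : ∀ r → InFq r → HasSize (S r) (2 ^ s′)
  S-size r r∈Fq = ≡.subst (HasSize (S r)) (count-S r∈Fq) (enumeration S-resp (S? r))

  S⊆T0 : ∀ r → InFq r → ∀ x → S r x → T0 x
  S⊆T0 r r∈Fq x trqx≈r = trans (trq2≈trq+trq^q x) (x≈y⇒x+y≈0 (trans trqx≈r (sym (trans (pow-cong q trqx≈r) r∈Fq))))

  T0⇒InFq-trq : ∀ {x} → T0 x → InFq (trq x)
  T0⇒InFq-trq {x} x∈T0 = sym (x+y≈0⇒x≈y (trans (sym (trq2≈trq+trq^q x)) x∈T0))

  T0⊆⋃S : ∀ x → T0 x → ∃ λ r → InFq r × S r x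
  T0⊆⋃S x x∈T0 = trq x , T0⇒InFq-trq x∈T0 , refl

  S-disjoint : ∀ r t → InFq r → InFq t → ∀ x → S r x → S t x → r ≈ t
  S-disjoint r t _ _ x trqx≈r trqx≈t = trans (sym trqx≈r) trqx≈t

  S-isCoset : ∀ r → InFq r → ∃ λ a → T0 a × IsCoset (S 0#) a (S r)
  S-isCoset r r∈Fq = φ x , S⊆T0 r r∈Fq (φ x) (G⇒S-φ trx≈r) , Sᶠ.fibre-isCoset (G⇒S-φ trx≈r)
    where
    x = proj₁ (tr-onto r∈Fq)
    trx≈r = proj₂ (tr-onto r∈Fq)

  coset-isS : ∀ a → T0 a → ∃ λ r → InFq r × IsCoset (S 0#) a (S r)
  coset-isS a a∈T0 = trq a , T0⇒InFq-trq a∈T0 , Sᶠ.fibre-isCoset refl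

  S⊕S : ∀ r t → InFq r → InFq t → (S r ⊕ S t) ≐ S (r + t)
  S⊕S r t r∈Fq _ = Sᶠ.fibre-⊕ t (G⇒S-φ (proj₂ (tr-onto r∈Fq)))

mainTheorem18 :
  (s : ℕ) → 1 ≤ s → (F : FiniteField (2 ^ (2 Nat.* s))) →
  let open FiniteField F
      open FieldNotions F s
  in
  -- S_0 = elements of F_q of absolute trace 0, S_1 = those of trace 1
  (S 0# ≐ (λ x → InFq x × (trq x ≈ 0#))) ×
  (S 1# ≐ (λ x → InFq x × (trq x ≈ 1#))) ×
  -- (i)
  (G 0# ≐ InFq) ×
  (∀ r → InFq r → ∃ λ a → IsCoset InFq a (G r)) ×
  (∀ a → ∃ λ r → InFq r × IsCoset InFq a (G r)) ×
  (∀ r t → InFq r → InFq t → (G r ⊕ G t) ≐ G (r + t)) ×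
  (∀ r → InFq r → ¬ (r ≈ 0#) → G r ≐ scaled r (G 1#)) ×
  -- (ii)
  (∀ r → InFq r → TwoToOneOnto φ (G r) (S r)) ×
  (∀ r → InFq r → HasSize (S r) (2 ^ (s ∸ 1))) ×
  (∀ r → InFq r → ∀ x → S r x → T0 x) ×
  (∀ x → T0 x → ∃ λ r → InFq r × S r x) ×
  (∀ r t → InFq r → InFq t → ∀ x → S r x → S t x → r ≈ t) ×
  (∀ r → InFq r → ∃ λ a → T0 a × IsCoset (S 0#) a (S r)) ×
  (∀ a → T0 a → ∃ λ r → InFq r × IsCoset (S 0#) a (S r)) ×
  (∀ r t → InFq r → InFq t → (S r ⊕ S t) ≐ S (r + t)) ×
  -- (iii)
  (∀ r → InFq r → G (r * r + r) ≐ (λ x → S r x ⊎ S (r + 1#) x))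
mainTheorem18 (suc s′) _ F =
  S0≐trace0 , S1≐trace1 , G0≐InFq , G-isCoset , coset-isG , G⊕G , G≐scaled-G1 ,
  φ-twoToOne , S-size , S⊆T0 , T0⊆⋃S , S-disjoint , S-isCoset , coset-isS , S⊕S , λ r _ → G≐S∪S+1 r
  where open TraceMaps s′ F
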